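{- The equational class $\mathcal{D}$ of distributive lattices (in the language $\{\wedge,\vee\}$) has unitary exact type: every finite $\mathcal{D}$-unifiable set $\Sigma$ of lattice identities has a $\mathcal{D}$-unifier $\sigma$ over $\mathrm{Var}(\Sigma)$ such that $\sigma'\sqsubseteq_{\mathcal{D}}\sigma$ for every $\mathcal{D}$-unifier $\sigma'$ of $\Sigma$ over $\mathrm{Var}(\Sigma)$.
   Context: $\mathbf{Fm}_{\mathcal{L}}(Y)$ is the formula algebra of the lattice language over variables $Y$, $\omega$ a countably infinite set of variables, $\mathrm{Var}(\Sigma)$ the variables occurring in $\Sigma$; $h_{\mathcal{D}}\colon\mathbf{Fm}_{\mathcal{L}}(Y)\to\mathbf{F}_{\mathcal{D}}(Y)$ is the canonical homomorphism onto the free distributive lattice, and $\ker(h)=\{(a,b)\mid h(a)=h(b)\}$. A substitution $\sigma\colon\mathbf{Fm}_{\mathcal{L}}(X)\to\mathbf{Fm}_{\mathcal{L}}(\omega)$ is a $\mathcal{D}$-unifier of $\Sigma$ if $\mathcal{D}\models\sigma(\varphi)\approx\sigma(\psi)$ for all $\varphi\approx\psi\in\Sigma$. $\sigma'\sqsubseteq_{\mathcal{D}}\sigma$ iff $\ker(h_{\mathcal{D}}\circ\sigma)\subseteq\ker(h_{\mathcal{D}}\circ\sigma')$. The exact type of a class is the maximal type, over finite unifiable $\Sigma$, of the set of unifiers of $\Sigma$ over $\mathrm{Var}(\Sigma)$ preordered by $\sqsubseteq$, where a preordered set has unitary type iff it has a $\mu$-set (complete set of pairwise incomparable elements, complete meaning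 every element lies below one of its members) of cardinality $1$. -}

module Defs where

open import Level using (0ℓ)
open import Data.Nat using (ℕ)
open import Data.Product using (_×_; _,_; ∃)
open import Data.List using (List; []; _∷_; _++_)
open import Data.List.Membership.Propositional using (_∈_)
open import Algebra.Lattice.Bundles using (DistributiveLattice)

data Fm : Set where
  var  : ℕ → Fm
  _∧ᶠ_ : Fm → Fm → Fm
  _∨ᶠ_ : Fm → Fm → Fm

Identity : Set
Identity = Fm × Fm

eval : (L : DistributiveLattice 0ℓ 0ℓ) → (ℕ → DistributiveLattice.Carrier L) → Fm → DistributiveLattice.Carrier L
eval L ρ (var x)   = ρ x
eval L ρ (φ ∧ᶠ ψ) = DistributiveLattice._∧_ L (eval L ρ φ) (eval L ρ ψ)
eval L ρ (φ ∨ᶠ ψ) = DistributiveLattice._∨_ L (eval L ρ φ) (eval L ρ ψ)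

-- 𝒟 ⊨ φ ≈ ψ : the identity holds in every distributive lattice
-- (equivalently h_𝒟(φ) = h_𝒟(ψ) in the free distributive lattice).
_⊨𝒟_ : Fm → Fm → Set₁
φ ⊨𝒟 ψ = (L : DistributiveLattice 0ℓ 0ℓ) (ρ : ℕ → DistributiveLattice.Carrier L) →
  DistributiveLattice._≈_ L (eval L ρ φ) (eval L ρ ψ)

-- Substitutions (only their values on Var(Σ) matter below).
Subst : Set
Subst = ℕ → Fm

_[_] : Fm → Subst → Fm
var x [ σ ]    = σ x
(φ ∧ᶠ ψ) [ σ ] = (φ [ σ ]) ∧ᶠ (ψ [ σ ])
(φ ∨ᶠ ψ) [ σ ] = (φ [ σ ]) ∨ᶠ (ψ [ σ ])

vars : Fm → List ℕ
vars (var x)   = x ∷ []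
vars (φ ∧ᶠ ψ) = vars φ ++ vars ψ
vars (φ ∨ᶠ ψ) = vars φ ++ vars ψ

Var : List Identity → List ℕ
Var []             = []
Var ((φ , ψ) ∷ Σ) = vars φ ++ vars ψ ++ Var Σ

FmOver : List ℕ → Fm → Set
FmOver X φ = ∀ {x} → x ∈ vars φ → x ∈ X

IsUnifier : List Identity → Subst → Set₁
IsUnifier Σ σ = ∀ {φ ψ} → (φ , ψ) ∈ Σ → (φ [ σ ]) ⊨𝒟 (ψ [ σ ])

Unifiable : List Identity → Set₁
Unifiable Σ = ∃ λ σ → IsUnifier Σ σ

-- σ' ⊑_𝒟 σ for substitutions with domain Fm_𝓛(X):
-- ker(h_𝒟 ∘ σ) ⊆ ker(h_𝒟 ∘ σ'), the kernels taken on Fm_𝓛(X).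
_⊑𝒟[_]_ : Subst → List ℕ → Subst → Set₁
σ' ⊑𝒟[ X ] σ = ∀ φ ψ → FmOver X φ → FmOver X ψ →
  (φ [ σ ]) ⊨𝒟 (ψ [ σ ]) → (φ [ σ' ]) ⊨𝒟 (ψ [ σ' ])

-- Two facts drive the proof. First, a distributive lattice satisfies every
-- quasi-identity Γ ⇒ φ ≈ ψ that holds in the two-element lattice 𝟚; this is
-- shown constructively by splitting on the variables one at a time, using that
-- c ∧ y ≤ e and c ≤ e ∨ y imply c ≤ e. Second, if S lists the 𝟚-models of Σ
-- on Var(Σ), there is a substitution whose Boolean images are exactly the
-- constant assignments and the members of S. It unifies Σ, since constant
-- assignments satisfy every lattice identity, and every 𝟚-model of Σ factors
-- through it; by the first fact applied to Γ = Σ under an arbitrary unifier σ′,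
-- σ′ satisfies every identity over Var(Σ) that this substitution makes valid.
module Submission where

open import Defs
open import Level using (0ℓ)
open import Function using (_∘_; id; const)
open import Data.Bool as Bool using (Bool; true; false; not)
open import Data.Bool.Properties as Boolₚ using ()
open import Data.Nat as ℕ using (ℕ; zero; suc; _≟_)
open import Data.Nat.Properties as ℕₚ using ()
open import Data.List using (List; []; _∷_; _++_; map; filter; length)
open import Data.List.Relation.Unary.Any using (here; there)
open import Data.List.Relation.Unary.All as All using (All; all?)
open import Data.List.Relation.Unary.All.Properties using (¬All⇒Any¬)
open import Data.List.Membership.Propositional using (_∈_; find)
open import Data.List.Membership.Propositional.Properties
  using (∈-++⁺ˡ; ∈-++⁺ʳ; ∈-map⁺; ∈-filter⁺; ∈-filter⁻)
open import Data.Product using (Σ-syntax; _×_; _,_; proj₁; proj₂)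
open import Data.Sum using (_⊎_; inj₁; inj₂; [_,_]′)
open import Data.Empty using (⊥-elim)
open import Relation.Nullary using (Dec; yes; no; does)
open import Relation.Nullary.Decidable using (dec-true; dec-false)
open import Relation.Binary.PropositionalEquality
  using (_≡_; _≢_; _≗_; refl; sym; trans; cong; cong₂; subst; subst₂; ≢-sym; module ≡-Reasoning)
open import Algebra.Lattice.Bundles using (DistributiveLattice)
import Algebra.Lattice.Properties.Lattice as LatticeProperties
import Relation.Binary.Lattice as OrderTheoretic

module _ (L : DistributiveLattice 0ℓ 0ℓ) where
  open DistributiveLattice L using (Carrier; _∧_; _∨_)

  eval-[] : ∀ (ρ : ℕ → Carrier) σ φ → eval L ρ (φ [ σ ]) ≡ eval L (eval L ρ ∘ σ) φ
  eval-[] ρ σ (var x)  = refl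
  eval-[] ρ σ (φ ∧ᶠ ψ) = cong₂ _∧_ (eval-[] ρ σ φ) (eval-[] ρ σ ψ)
  eval-[] ρ σ (φ ∨ᶠ ψ) = cong₂ _∨_ (eval-[] ρ σ φ) (eval-[] ρ σ ψ)

  eval-cong : ∀ {ρ ρ′ : ℕ → Carrier} φ → (∀ {x} → x ∈ vars φ → ρ x ≡ ρ′ x) →
    eval L ρ φ ≡ eval L ρ′ φ
  eval-cong (var x)  ρ≡ρ′ = ρ≡ρ′ (here refl)
  eval-cong (φ ∧ᶠ ψ) ρ≡ρ′ =
    cong₂ _∧_ (eval-cong φ (ρ≡ρ′ ∘ ∈-++⁺ˡ)) (eval-cong ψ (ρ≡ρ′ ∘ ∈-++⁺ʳ (vars φ)))
  eval-cong (φ ∨ᶠ ψ) ρ≡ρ′ =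
    cong₂ _∨_ (eval-cong φ (ρ≡ρ′ ∘ ∈-++⁺ˡ)) (eval-cong ψ (ρ≡ρ′ ∘ ∈-++⁺ʳ (vars φ)))

Var-∈ : ∀ {Γ φ ψ} → (φ , ψ) ∈ Γ → FmOver (Var Γ) φ × FmOver (Var Γ) ψ
Var-∈ {(φ , ψ) ∷ Γ} (here refl) = ∈-++⁺ˡ , ∈-++⁺ʳ (vars φ) ∘ ∈-++⁺ˡ
Var-∈ {(φ′ , ψ′) ∷ Γ} (there e∈Γ) =
  let (φ⊆Γ , ψ⊆Γ) = Var-∈ e∈Γ
  in  ∈-++⁺ʳ (vars φ′) ∘ ∈-++⁺ʳ (vars ψ′) ∘ φ⊆Γ , ∈-++⁺ʳ (vars φ′) ∘ ∈-++⁺ʳ (vars ψ′) ∘ ψ⊆Γ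

𝟚 : DistributiveLattice 0ℓ 0ℓ
𝟚 = Boolₚ.∨-∧-distributiveLattice

evalB : (ℕ → Bool) → Fm → Bool
evalB = eval 𝟚

evalB-const : ∀ b φ → evalB (const b) φ ≡ b
evalB-const b (var x)  = refl
evalB-const b (φ ∧ᶠ ψ) = trans (cong₂ Bool._∧_ (evalB-const b φ) (evalB-const b ψ)) (Boolₚ.∧-idem b)
evalB-const b (φ ∨ᶠ ψ) = trans (cong₂ Bool._∨_ (evalB-const b φ) (evalB-const b ψ)) (Boolₚ.∨-idem b)

_⊨_ : (ℕ → Bool) → Identity → Set
s ⊨ e = evalB s (proj₁ e) ≡ evalB s (proj₂ e)

_⊨?_ : ∀ s e → Dec (s ⊨ e)
s ⊨? e = evalB s (proj₁ e) Boolₚ.≟ evalB s (proj₂ e)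

IsModel : List Identity → (ℕ → Bool) → Set
IsModel Γ s = All (s ⊨_) Γ

isModel? : ∀ Γ s → Dec (IsModel Γ s)
isModel? Γ s = all? (s ⊨?_) Γ

IsModel-cong : ∀ Γ {s t} → (∀ {x} → x ∈ Var Γ → s x ≡ t x) → IsModel Γ s → IsModel Γ t
IsModel-cong Γ {s} {t} s≡t s⊨Γ = All.tabulate t⊨
  where
  t⊨ : ∀ {e} → e ∈ Γ → t ⊨ e
  t⊨ {φ , ψ} e∈Γ = let (φ⊆Γ , ψ⊆Γ) = Var-∈ e∈Γ in begin
    evalB t φ ≡⟨ sym (eval-cong 𝟚 φ (s≡t ∘ φ⊆Γ)) ⟩
    evalB s φ ≡⟨ All.lookup s⊨Γ e∈Γ ⟩
    evalB s ψ ≡⟨ eval-cong 𝟚 ψ (s≡t ∘ ψ⊆Γ) ⟩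
    evalB t ψ ∎
    where open ≡-Reasoning

upd : (ℕ → Bool) → ℕ → Bool → ℕ → Bool
upd s y b x with x ≟ y
... | yes _ = b
... | no  _ = s x

module Completeness (L : DistributiveLattice 0ℓ 0ℓ) (τ : ℕ → DistributiveLattice.Carrier L) where
  open DistributiveLattice L using (Carrier; _≈_; _∧_; _∨_; ∧-distribˡ-∨; lattice)
    renaming (trans to ≈-trans; sym to ≈-sym)
  open OrderTheoretic.Lattice (LatticeProperties.∨-∧-orderTheoreticLattice lattice)
    using (_≤_; antisym; x≤x∨y; y≤x∨y; ∨-least; x∧y≤x; x∧y≤y; ∧-greatest)
    renaming (refl to ≤-refl; trans to ≤-trans; reflexive to ≤-reflexive)

  ⟦_⟧ : Fm → Carrier
  ⟦_⟧ = eval L τ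

  -- c ≤ e ∨ y unfolds to c ≈ c ∧ (e ∨ y), which distributes to (c ∧ e) ∨ (c ∧ y).
  ≤-split : ∀ {c y e} → c ∧ y ≤ e → c ≤ e ∨ y → c ≤ e
  ≤-split {c} {y} {e} c∧y≤e c≤e∨y =
    ≤-trans (≤-reflexive (≈-trans c≤e∨y (∧-distribˡ-∨ c e y))) (∨-least (x∧y≤y c e) c∧y≤e)

  Bounded : Carrier → Carrier → Bool → Carrier → Set
  Bounded c d true  a = c ≤ a
  Bounded c d false a = a ≤ d

  Bounded-mono : ∀ {c c′ d d′} → c′ ≤ c → d ≤ d′ → ∀ b {a} → Bounded c d b a → Bounded c′ d′ b a
  Bounded-mono c′≤c d≤d′ true  c≤a = ≤-trans c′≤c c≤a
  Bounded-mono c′≤c d≤d′ false a≤d = ≤-trans a≤d d≤d′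

  ∧-bounded : ∀ {c d} b b′ {a a′} → Bounded c d b a → Bounded c d b′ a′ →
    Bounded c d (b Bool.∧ b′) (a ∧ a′)
  ∧-bounded true  true  c≤a c≤a′ = ∧-greatest c≤a c≤a′
  ∧-bounded true  false _   a′≤d = ≤-trans (x∧y≤y _ _) a′≤d
  ∧-bounded false _     a≤d _    = ≤-trans (x∧y≤x _ _) a≤d

  ∨-bounded : ∀ {c d} b b′ {a a′} → Bounded c d b a → Bounded c d b′ a′ →
    Bounded c d (b Bool.∨ b′) (a ∨ a′)
  ∨-bounded true  _     c≤a  _    = ≤-trans c≤a (x≤x∨y _ _)
  ∨-bounded false true  _    c≤a′ = ≤-trans c≤a′ (y≤x∨y _ _)
  ∨-bounded false false a≤d  a′≤d = ∨-least a≤d a′≤d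

  -- Invariant of the case split on the variables in D: c is ⟦ φ ⟧ met with the
  -- variables set true, d is ⟦ ψ ⟧ joined with those set false.
  Brackets : List ℕ → (ℕ → Bool) → Carrier → Carrier → Set
  Brackets D s c d = ∀ {x} → x ∈ D → Bounded c d (s x) (τ x)

  eval-bounded : ∀ {D s c d} φ → Brackets D s c d → FmOver D φ → Bounded c d (evalB s φ) ⟦ φ ⟧
  eval-bounded (var x) B φ⊆D = B (φ⊆D (here refl))
  eval-bounded {s = s} (φ ∧ᶠ ψ) B φψ⊆D = ∧-bounded (evalB s φ) (evalB s ψ)
    (eval-bounded φ B (φψ⊆D ∘ ∈-++⁺ˡ)) (eval-bounded ψ B (φψ⊆D ∘ ∈-++⁺ʳ (vars φ)))
  eval-bounded {s = s} (φ ∨ᶠ ψ) B φψ⊆D = ∨-bounded (evalB s φ) (evalB s ψ)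
    (eval-bounded φ B (φψ⊆D ∘ ∈-++⁺ˡ)) (eval-bounded ψ B (φψ⊆D ∘ ∈-++⁺ʳ (vars φ)))

  Brackets-∷ : ∀ {D s c c′ d d′ y} b → Brackets D s c d → c′ ≤ c → d ≤ d′ →
    Bounded c′ d′ b (τ y) → Brackets (y ∷ D) (upd s y b) c′ d′
  Brackets-∷ {y = y} b B c′≤c d≤d′ y-bounded {x} x∈y∷D with x ≟ y
  ... | yes refl = y-bounded
  Brackets-∷ b B c′≤c d≤d′ y-bounded (here refl) | no x≢y = ⊥-elim (x≢y refl)
  Brackets-∷ {s = s} b B c′≤c d≤d′ y-bounded {x} (there x∈D) | no _ =
    Bounded-mono c′≤c d≤d′ (s x) (B x∈D)

  module _ {Γ : List Identity} (τ⊨Γ : ∀ {a b} → (a , b) ∈ Γ → ⟦ a ⟧ ≈ ⟦ b ⟧)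
           (φ ψ : Fm) (agree : ∀ t → IsModel Γ t → evalB t φ ≡ evalB t ψ) where

    X : List ℕ
    X = Var Γ ++ vars φ ++ vars ψ

    decided : ∀ {D s c d} → (∀ {x} → x ∈ X → x ∈ D) → Brackets D s c d →
      c ≤ ⟦ φ ⟧ → ⟦ ψ ⟧ ≤ d → c ≤ d
    decided {s = s} {c} {d} X⊆D B c≤φ ψ≤d with isModel? Γ s
    ... | yes s⊨Γ = by-model (evalB s φ) (eval-bounded φ B (X⊆D ∘ ∈-++⁺ʳ (Var Γ) ∘ ∈-++⁺ˡ))
          (subst (λ b → Bounded c d b ⟦ ψ ⟧) (sym (agree s s⊨Γ))
            (eval-bounded ψ B (X⊆D ∘ ∈-++⁺ʳ (Var Γ) ∘ ∈-++⁺ʳ (vars φ))))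
      where
      by-model : ∀ b → Bounded c d b ⟦ φ ⟧ → Bounded c d b ⟦ ψ ⟧ → c ≤ d
      by-model true  _   c≤ψ = ≤-trans c≤ψ ψ≤d
      by-model false φ≤d _   = ≤-trans c≤φ φ≤d
    ... | no s⊭Γ with find (¬All⇒Any¬ (s ⊨?_) Γ s⊭Γ)
    ...   | (a , b) , ab∈Γ , s⊭ab =
      by-conflict (evalB s a) (evalB s b) s⊭ab (eval-bounded a B (X⊆D ∘ ∈-++⁺ˡ ∘ a⊆Γ))
        (eval-bounded b B (X⊆D ∘ ∈-++⁺ˡ ∘ b⊆Γ))
      where
      a⊆Γ = proj₁ (Var-∈ ab∈Γ)
      b⊆Γ = proj₂ (Var-∈ ab∈Γ)
      by-conflict : ∀ u v → u ≢ v → Bounded c d u ⟦ a ⟧ → Bounded c d v ⟦ b ⟧ → c ≤ d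
      by-conflict true  true  u≢v _ _ = ⊥-elim (u≢v refl)
      by-conflict false false u≢v _ _ = ⊥-elim (u≢v refl)
      by-conflict true  false _ c≤a b≤d = ≤-trans c≤a (≤-trans (≤-reflexive (τ⊨Γ ab∈Γ)) b≤d)
      by-conflict false true  _ a≤d c≤b = ≤-trans c≤b (≤-trans (≤-reflexive (≈-sym (τ⊨Γ ab∈Γ))) a≤d)

    by-cases : ∀ R {D s c d} → (∀ {x} → x ∈ X → x ∈ D ⊎ x ∈ R) → Brackets D s c d →
      c ≤ ⟦ φ ⟧ → ⟦ ψ ⟧ ≤ d → c ≤ d
    by-cases [] {s = s} X⊆D⊎[] = decided {s = s} ([ id , (λ ()) ]′ ∘ X⊆D⊎[])
    by-cases (y ∷ R) {D} {s} X⊆D⊎R B c≤φ ψ≤d = ≤-split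
      (by-cases R {s = upd s y true} X⊆D⊎R′ (Brackets-∷ true B (x∧y≤x _ _) ≤-refl (x∧y≤y _ _))
        (≤-trans (x∧y≤x _ _) c≤φ) ψ≤d)
      (by-cases R {s = upd s y false} X⊆D⊎R′ (Brackets-∷ false B ≤-refl (x≤x∨y _ _) (y≤x∨y _ _))
        c≤φ (≤-trans ψ≤d (x≤x∨y _ _)))
      where
      X⊆D⊎R′ : ∀ {x} → x ∈ X → x ∈ y ∷ D ⊎ x ∈ R
      X⊆D⊎R′ x∈X with X⊆D⊎R x∈X
      ... | inj₁ x∈D         = inj₁ (there x∈D)
      ... | inj₂ (here refl) = inj₁ (here refl)
      ... | inj₂ (there x∈R) = inj₂ x∈R

    ≤-from-𝟚-models : ⟦ φ ⟧ ≤ ⟦ ψ ⟧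
    ≤-from-𝟚-models = by-cases X {D = []} {s = const false} inj₂ (λ ()) ≤-refl ≤-refl

  ≈-from-𝟚-models : ∀ {Γ} → (∀ {a b} → (a , b) ∈ Γ → ⟦ a ⟧ ≈ ⟦ b ⟧) →
    ∀ φ ψ → (∀ t → IsModel Γ t → evalB t φ ≡ evalB t ψ) → ⟦ φ ⟧ ≈ ⟦ ψ ⟧
  ≈-from-𝟚-models τ⊨Γ φ ψ agree =
    antisym (≤-from-𝟚-models τ⊨Γ φ ψ agree) (≤-from-𝟚-models τ⊨Γ ψ φ (λ t t⊨Γ → sym (agree t t⊨Γ)))

open Completeness using (≈-from-𝟚-models)

orIf : Bool → Fm → Fm → Fm
orIf true  φ ψ = φ ∨ᶠ ψ
orIf false φ _ = φ

meetFrom : ℕ → ℕ → Fm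
meetFrom zero    n = var n
meetFrom (suc k) n = var n ∧ᶠ meetFrom k (suc n)

-- The i-th member of S is guarded by the variable n + i. Under ρ, if the i-th
-- member s is the first whose guard is false, x ↦ selector S n x evaluates to s
-- when all later variables are true and to false otherwise; if no guard is
-- false, the image is constant.
selector : List (ℕ → Bool) → ℕ → Subst
selector []      n x = var n
selector (s ∷ S) n x = orIf (s x) (var n ∧ᶠ selector S (suc n) x) (meetFrom (length S) (suc n))

meetFrom⇒selector : ∀ S n x ρ →
  evalB ρ (meetFrom (length S) n) ≡ true → evalB ρ (selector S n x) ≡ true
meetFrom⇒selector []      n x ρ ρn = ρn
meetFrom⇒selector (s ∷ S) n x ρ ρn∧meet with s x
... | true  = trans (cong (evalB ρ (var n ∧ᶠ selector S (suc n) x) Bool.∨_) meet) (Boolₚ.∨-zeroʳ _)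
  where meet = Boolₚ.∧-conicalʳ (ρ n) _ ρn∧meet
... | false = cong₂ Bool._∧_ (Boolₚ.∧-conicalˡ (ρ n) _ ρn∧meet)
                (meetFrom⇒selector S (suc n) x ρ (Boolₚ.∧-conicalʳ (ρ n) _ ρn∧meet))

selector-skip : ∀ s S n x ρ → ρ n ≡ true →
  evalB ρ (selector (s ∷ S) n x) ≡ evalB ρ (selector S (suc n) x)
selector-skip s S n x ρ ρn with s x
... | false rewrite ρn = refl
... | true  rewrite ρn with evalB ρ (meetFrom (length S) (suc n)) in meet
...   | false = Boolₚ.∨-identityʳ _
...   | true  rewrite meetFrom⇒selector S (suc n) x ρ meet = refl

selector-stop : ∀ s S n x ρ → ρ n ≡ false →
  evalB ρ (selector (s ∷ S) n x) ≡ s x Bool.∧ evalB ρ (meetFrom (length S) (suc n))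
selector-stop s S n x ρ ρn with s x
... | false rewrite ρn = refl
... | true  rewrite ρn = refl

Shape : List (ℕ → Bool) → (ℕ → Bool) → Set
Shape S f = (Σ[ b ∈ Bool ] f ≗ const b) ⊎ (Σ[ s ∈ (ℕ → Bool) ] s ∈ S × f ≗ s)

Shape-∷ : ∀ {s S f g} → f ≗ g → Shape S g → Shape (s ∷ S) f
Shape-∷ f≗g (inj₁ (b , g≗b))       = inj₁ (b , λ x → trans (f≗g x) (g≗b x))
Shape-∷ f≗g (inj₂ (s , s∈S , g≗s)) = inj₂ (s , there s∈S , λ x → trans (f≗g x) (g≗s x))

selector-shape : ∀ S n ρ → Shape S (evalB ρ ∘ selector S n)
selector-shape []      n ρ = inj₁ (ρ n , λ _ → refl)
selector-shape (s ∷ S) n ρ with ρ n in ρn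
... | true = Shape-∷ (λ x → selector-skip s S n x ρ ρn) (selector-shape S (suc n) ρ)
... | false with evalB ρ (meetFrom (length S) (suc n)) in meet
...   | true  = inj₂ (s , here refl , λ x →
          trans (selector-stop s S n x ρ ρn) (trans (cong (s x Bool.∧_) meet) (Boolₚ.∧-identityʳ (s x))))
...   | false = inj₁ (false , λ x →
          trans (selector-stop s S n x ρ ρn) (trans (cong (s x Bool.∧_) meet) (Boolₚ.∧-zeroʳ (s x))))

Shape-model : ∀ Γ {S f} → (∀ {s} → s ∈ S → IsModel Γ s) → Shape S f → IsModel Γ f
Shape-model Γ {f = f} S⊨Γ (inj₁ (b , f≗b)) = All.tabulate f⊨
  where
  evalB-f : ∀ φ → evalB f φ ≡ b
  evalB-f φ = trans (eval-cong 𝟚 φ (λ {x} _ → f≗b x)) (evalB-const b φ)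
  f⊨ : ∀ {e} → e ∈ Γ → f ⊨ e
  f⊨ {φ , ψ} _ = trans (evalB-f φ) (sym (evalB-f ψ))
Shape-model Γ S⊨Γ (inj₂ (s , s∈S , f≗s)) = IsModel-cong Γ (λ {x} _ → sym (f≗s x)) (S⊨Γ s∈S)

falseOnlyAt : ℕ → ℕ → Bool
falseOnlyAt m k = not (does (k ≟ m))

meetFrom-true : ∀ l n ρ → (∀ {k} → n ℕ.≤ k → ρ k ≡ true) → evalB ρ (meetFrom l n) ≡ true
meetFrom-true zero    n ρ ρ≥n = ρ≥n ℕₚ.≤-refl
meetFrom-true (suc l) n ρ ρ≥n =
  cong₂ Bool._∧_ (ρ≥n ℕₚ.≤-refl) (meetFrom-true l (suc n) ρ (ρ≥n ∘ ℕₚ.<⇒≤))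

selector-realises : ∀ S n {s} → s ∈ S →
  Σ[ m ∈ ℕ ] (n ℕ.≤ m × evalB (falseOnlyAt m) ∘ selector S n ≗ s)
selector-realises (s ∷ S) n (here refl) = n , ℕₚ.≤-refl , λ x → begin
  evalB ρ (selector (s ∷ S) n x)                      ≡⟨ selector-stop s S n x ρ ρn ⟩
  s x Bool.∧ evalB ρ (meetFrom (length S) (suc n))   ≡⟨ cong (s x Bool.∧_) (meetFrom-true (length S) (suc n) ρ ρ>n) ⟩
  s x Bool.∧ true                                     ≡⟨ Boolₚ.∧-identityʳ (s x) ⟩
  s x                                                 ∎
  where
  open ≡-Reasoning
  ρ = falseOnlyAt n
  ρn : ρ n ≡ false
  ρn = cong not (dec-true (n ≟ n) refl)
  ρ>n : ∀ {k} → suc n ℕ.≤ k → ρ k ≡ true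
  ρ>n n<k = cong not (dec-false (_ ≟ n) (≢-sym (ℕₚ.<⇒≢ n<k)))
selector-realises (t ∷ S) n (there s∈S) with selector-realises S (suc n) s∈S
... | m , n<m , ρ↦s = m , ℕₚ.<⇒≤ n<m , λ x → trans (selector-skip t S n x ρ ρn) (ρ↦s x)
  where
  ρ = falseOnlyAt m
  ρn : ρ n ≡ true
  ρn = cong not (dec-false (n ≟ m) (ℕₚ.<⇒≢ n<m))

assignments : List ℕ → List (ℕ → Bool)
assignments []      = const false ∷ []
assignments (x ∷ X) =
  map (λ s → upd s x true) (assignments X) ++ map (λ s → upd s x false) (assignments X)

upd-∈-assignments : ∀ x X {s} b → s ∈ assignments X → upd s x b ∈ assignments (x ∷ X)
upd-∈-assignments x X true  s∈A = ∈-++⁺ˡ (∈-map⁺ _ s∈A)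
upd-∈-assignments x X false s∈A = ∈-++⁺ʳ _ (∈-map⁺ _ s∈A)

assignments-cover : ∀ X (t : ℕ → Bool) →
  Σ[ s ∈ (ℕ → Bool) ] (s ∈ assignments X × (∀ {x} → x ∈ X → s x ≡ t x))
assignments-cover []      t = const false , here refl , λ ()
assignments-cover (x ∷ X) t with assignments-cover X t
... | s , s∈A , s≡t = upd s x (t x) , upd-∈-assignments x X (t x) s∈A , agree
  where
  agree : ∀ {z} → z ∈ x ∷ X → upd s x (t x) z ≡ t z
  agree {z} z∈x∷X with z ≟ x
  ... | yes refl = refl
  agree (here refl)  | no z≢x = ⊥-elim (z≢x refl)
  agree (there z∈X)  | no _   = s≡t z∈X

models : List Identity → List (ℕ → Bool)
models Σ = filter (isModel? Σ) (assignments (Var Σ))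

mgu : List Identity → Subst
mgu Σ = selector (models Σ) 0

mgu-image-model : ∀ Σ ρ → IsModel Σ (evalB ρ ∘ mgu Σ)
mgu-image-model Σ ρ =
  Shape-model Σ (proj₂ ∘ ∈-filter⁻ (isModel? Σ) {xs = assignments (Var Σ)})
    (selector-shape (models Σ) 0 ρ)

mgu-realises : ∀ Σ t → IsModel Σ t →
  Σ[ ρ ∈ (ℕ → Bool) ] (∀ {x} → x ∈ Var Σ → evalB ρ (mgu Σ x) ≡ t x)
mgu-realises Σ t t⊨Σ =
  let s , s∈A , s≡t = assignments-cover (Var Σ) t
      s∈models      = ∈-filter⁺ (isModel? Σ) s∈A (IsModel-cong Σ (sym ∘ s≡t) t⊨Σ)
      m , _ , ρ↦s   = selector-realises (models Σ) 0 s∈models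
  in  falseOnlyAt m , λ {x} x∈Σ → trans (ρ↦s x) (s≡t x∈Σ)

mgu-unifies : ∀ Σ → IsUnifier Σ (mgu Σ)
mgu-unifies Σ {φ} {ψ} φψ∈Σ L ρ =
  ≈-from-𝟚-models L ρ {Γ = []} (λ ()) (φ [ mgu Σ ]) (ψ [ mgu Σ ]) agree
  where
  agree : ∀ t → IsModel [] t → evalB t (φ [ mgu Σ ]) ≡ evalB t (ψ [ mgu Σ ])
  agree t _ = begin
    evalB t (φ [ mgu Σ ])       ≡⟨ eval-[] 𝟚 t (mgu Σ) φ ⟩
    evalB (evalB t ∘ mgu Σ) φ  ≡⟨ All.lookup (mgu-image-model Σ t) φψ∈Σ ⟩
    evalB (evalB t ∘ mgu Σ) ψ  ≡⟨ sym (eval-[] 𝟚 t (mgu Σ) ψ) ⟩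
    evalB t (ψ [ mgu Σ ])       ∎
    where open ≡-Reasoning

mgu-most-general : ∀ Σ σ′ → IsUnifier Σ σ′ → σ′ ⊑𝒟[ Var Σ ] mgu Σ
mgu-most-general Σ σ′ σ′-unifies φ ψ φ⊆Σ ψ⊆Σ mgu-unifies-φψ L ρ =
  subst₂ _≈_ (sym (eval-[] L ρ σ′ φ)) (sym (eval-[] L ρ σ′ ψ))
    (≈-from-𝟚-models L (eval L ρ ∘ σ′) τ⊨Σ φ ψ agree)
  where
  open DistributiveLattice L using (_≈_)
  τ⊨Σ : ∀ {a b} → (a , b) ∈ Σ → eval L (eval L ρ ∘ σ′) a ≈ eval L (eval L ρ ∘ σ′) b
  τ⊨Σ {a} {b} ab∈Σ = subst₂ _≈_ (eval-[] L ρ σ′ a) (eval-[] L ρ σ′ b) (σ′-unifies ab∈Σ L ρ)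
  agree : ∀ t → IsModel Σ t → evalB t φ ≡ evalB t ψ
  agree t t⊨Σ with mgu-realises Σ t t⊨Σ
  ... | ρ₀ , ρ₀↦t = begin
    evalB t φ                     ≡⟨ sym (eval-cong 𝟚 φ (ρ₀↦t ∘ φ⊆Σ)) ⟩
    evalB (evalB ρ₀ ∘ mgu Σ) φ   ≡⟨ sym (eval-[] 𝟚 ρ₀ (mgu Σ) φ) ⟩
    evalB ρ₀ (φ [ mgu Σ ])        ≡⟨ mgu-unifies-φψ 𝟚 ρ₀ ⟩
    evalB ρ₀ (ψ [ mgu Σ ])        ≡⟨ eval-[] 𝟚 ρ₀ (mgu Σ) ψ ⟩
    evalB (evalB ρ₀ ∘ mgu Σ) ψ   ≡⟨ eval-cong 𝟚 ψ (ρ₀↦t ∘ ψ⊆Σ) ⟩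
    evalB t ψ                     ∎
    where open ≡-Reasoning

mainTheorem10 : (Σ : List Identity) → Unifiable Σ →
    Σ[ σ ∈ Subst ] (IsUnifier Σ σ × ((σ' : Subst) → IsUnifier Σ σ' → σ' ⊑𝒟[ Var Σ ] σ))
mainTheorem10 Σ _ = mgu Σ , mgu-unifies Σ , mgu-most-general Σ
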